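{- Let $b\ge2$ be an integer, let $g:\mathbb{Z}_{\ge0}\to\mathbb{C}$ be an arbitrary sequence, and define formally, for $n\ge1$, \[ f(n)=\sum_{k\ge0}\sum_{l=0}^{b^{k}-1}g\left(b^{k}n+l\right). \] Then, as identities of formal sums, $g(n)=f(n)-\sum_{j=0}^{b-1}f(bn+j)$ for every $n\ge 1$, and \[ \sum_{n\ge1}s_{b}(n)g(n)=\sum_{j=1}^{b-1}j\sum_{n,k\ge0}\sum_{l=0}^{b^{k}-1}g\left(b^{k+1}n+b^{k}j+l\right). \]
   Context: $s_b(n)$ denotes the sum of the digits of the base-$b$ expansion of $n$. "Identity of formal sums" means: when both sides are expanded as formal linear combinations of the symbols $g(m)$, $m\ge0$, each symbol $g(m)$ occurs with the same (finite) coefficient on both sides. -}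

module Defs where

open import Data.Nat using (_≟_; ℕ; zero; suc; _+_; _*_; _^_; _<_; _%_; _/_)
open import Data.Product using (_×_; _,_; Σ)
open import Data.List using (List; length)
open import Data.List.Membership.Propositional using (_∈_)
open import Data.List.Relation.Unary.Unique.Propositional using (Unique)
open import Function.Bundles using (_⇔_)
open import Relation.Binary.PropositionalEquality using (_≡_)
open import Relation.Nullary using (yes; no)

-- Sum of the base-b digits of n, computed with fuel.
-- (Fuel n suffices for every b ≥ 2, since each step divides by b.)
digitSumAux : ℕ → ℕ → ℕ → ℕ
digitSumAux b       zero    n = 0
digitSumAux zero    (suc f) n = 0
digitSumAux (suc c) (suc f) n = n % suc c + digitSumAux (suc c) f (n / suc c)

digitSum : ℕ → ℕ → ℕ
digitSum b n = digitSumAux b n n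

Count : {A : Set} → (A → Set) → ℕ → Set
Count {A} P c = Σ (List A) λ L → Unique L × ((x : A) → (x ∈ L) ⇔ P x) × length L ≡ c

-- Index (k , l) of the term g(b^k n + l) of f(n) that equals the symbol g(m).
FTerm : ℕ → ℕ → ℕ → ℕ × ℕ → Set
FTerm b n m (k , l) = l < b ^ k × b ^ k * n + l ≡ m

-- Index (n , k , l) of the term g(b^(k+1) n + b^k j + l) on the right-hand
-- side of the second identity (for fixed j) that equals the symbol g(m).
RTerm : ℕ → ℕ → ℕ → ℕ × ℕ × ℕ → Set
RTerm b j m (n , k , l) = l < b ^ k × b ^ suc k * n + b ^ k * j + l ≡ m

-- Coefficient of g(m) in  Σ_{n ≥ 1} s_b(n) g(n).
lhsCoef : ℕ → ℕ → ℕ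
lhsCoef b zero    = 0
lhsCoef b (suc m) = digitSum b (suc m)

-- Coefficient of g(m) in the single symbol g(n).
δ : ℕ → ℕ → ℕ
δ m n with m ≟ n
... | yes _ = 1
... | no  _ = 0

module Submission where

-- Fix m and write q k = ⌊m / b^k⌋, so that the k-th base-b digit of m is
-- q k mod b.  For a ≥ 1 and l < b^k we have b^k a + l = m exactly when
-- a = q k and l = m mod b^k, and such a k lies below every N with m < b^N.
-- Hence, for any such range N,
--   * the coefficient of g(m) in f(n) is #{k < N : q k = n}   (FTerm-count),
--   * the coefficient of g(m) in the j-th inner sum (1 ≤ j < b) is
--     #{k < N : the k-th digit of m is j}                        (RTerm-count).
-- Writing these counts as finite sums of Kronecker deltas, both identities
-- become manipulations of finite sums:
--   * the children b n + j (j < b) of n collect exactly the k with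
--     q (k+1) = n; counting f(n) over k < m+1 and f(bn+j) over k < m
--     gives f(n) = g(n) + Σ_j f(bn+j) on the nose             (f-recursion);
--   * grouping the digits of m by value gives
--     s_b(m) = Σ_j j · #{k : digit_k(m) = j}                  (digits-by-value).

open import Defs
open import Data.Nat using (ℕ; zero; suc; _+_; _*_; _∸_; _≤_; _<_; _^_; _/_; _%_; NonZero; z≤n; s≤s; _≟_)
open import Data.Nat.Properties
open import Data.Nat.DivMod
open import Data.Nat.ListAction using (sum)
import Data.Nat as ℕ
open import Data.Nat.Solver using (module +-*-Solver)
open import Data.Fin using (toℕ)
open import Data.Fin.Properties using (toℕ<n)
open import Data.List using (List; map; upTo; applyUpTo; filter; length)
open import Data.List.Properties using (length-map; map-∘; filter-accept; filter-reject)
open import Data.List.Membership.Propositional using (_∈_)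
open import Data.List.Membership.Propositional.Properties
  using (∈-map⁺; ∈-map⁻; ∈-filter⁺; ∈-filter⁻; ∈-upTo⁺; ∈-upTo⁻)
open import Data.List.Membership.Propositional.Properties.WithK using (unique∧set⇒bag)
open import Data.List.Relation.Binary.BagAndSetEquality using (∼bag⇒↭)
open import Data.List.Relation.Binary.Permutation.Propositional.Properties using (↭-length)
import Data.List.Relation.Unary.Unique.Propositional.Properties as Unique
open import Data.Integer using (+_; _-_; _⊖_)
import Data.Integer.Properties as ℤ
open import Data.Product using (_×_; _,_; ∃-syntax; proj₁; proj₂)
open import Function using (_∘_; id)
open import Function.Bundles using (_⇔_; mk⇔; Equivalence)
open import Relation.Binary.PropositionalEquality
open import Relation.Nullary using (Dec; yes; no; ¬_; contradiction)
open import Algebra.Properties.Semiring.Sum +-*-semiring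
  using (sum-syntax; sum-cong-≗; sum-replicate-zero; ∑-comm; *-distribˡ-sum)

Count-unique : {A : Set} {P : A → Set} {c c′ : ℕ} → Count P c → Count P c′ → c ≡ c′
Count-unique (L , uL , memL , refl) (L′ , uL′ , memL′ , refl) =
  ↭-length (∼bag⇒↭ (unique∧set⇒bag uL uL′ (λ {x} → mk⇔
    (Equivalence.from (memL′ x) ∘ Equivalence.to (memL x))
    (Equivalence.from (memL x) ∘ Equivalence.to (memL′ x)))))

Count-image : {A I : Set} {P : A → Set} {R : I → Set} {c : ℕ}
  (e : I → A) (π : A → I) → (∀ i → π (e i) ≡ i) →
  (∀ i → R i → P (e i)) → (∀ x → P x → R (π x) × e (π x) ≡ x) →
  Count R c → Count P c
Count-image {P = P} {R} e π πe sound complete (L , uL , memL , lenL) =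
  map e L , Unique.map⁺ e-injective uL , mem , trans (length-map e L) lenL
  where
  e-injective : ∀ {i j} → e i ≡ e j → i ≡ j
  e-injective {i} {j} eq = trans (sym (πe i)) (trans (cong π eq) (πe j))
  mem : ∀ x → (x ∈ map e L) ⇔ P x
  mem x = mk⇔ to from
    where
    to : x ∈ map e L → P x
    to x∈ with ∈-map⁻ e x∈
    ... | i , i∈L , refl = sound i (Equivalence.to (memL i) i∈L)
    from : P x → x ∈ map e L
    from Px with complete x Px
    ... | Rπx , eπx≡x = subst (_∈ map e L) eπx≡x (∈-map⁺ e (Equivalence.from (memL (π x)) Rπx))

δ-yes : ∀ {x y} → x ≡ y → δ x y ≡ 1
δ-yes {x} {y} x≡y with x ≟ y
... | yes _ = refl
... | no x≢y = contradiction x≡y x≢y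

δ-no : ∀ {x y} → ¬ x ≡ y → δ x y ≡ 0
δ-no {x} {y} x≢y with x ≟ y
... | yes x≡y = contradiction x≡y x≢y
... | no _ = refl

δ-suc : ∀ x y → δ (suc x) (suc y) ≡ δ x y
δ-suc x y with x ≟ y
... | yes x≡y = δ-yes (cong suc x≡y)
... | no x≢y = δ-no (x≢y ∘ suc-injective)

length-filter-≟ : ∀ (h f : ℕ → ℕ) t N →
  length (filter (λ k → h k ≟ t) (applyUpTo f N)) ≡ ∑[ i < N ] δ (h (f (toℕ i))) t
length-filter-≟ h f t zero = refl
length-filter-≟ h f t (suc N) = by-head (h (f 0) ≟ t)
  where
  open ≡-Reasoning
  rest : ℕ
  rest = length (filter (λ k → h k ≟ t) (applyUpTo (f ∘ suc) N))
  by-head : Dec (h (f 0) ≡ t) →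
    length (filter (λ k → h k ≟ t) (applyUpTo f (suc N))) ≡ ∑[ i < suc N ] δ (h (f (toℕ i))) t
  by-head (yes hit) = begin
    length (filter (λ k → h k ≟ t) (applyUpTo f (suc N)))
      ≡⟨ cong length (filter-accept (λ k → h k ≟ t) {xs = applyUpTo (f ∘ suc) N} hit) ⟩
    1 + rest ≡⟨ cong₂ _+_ (sym (δ-yes hit)) (length-filter-≟ h (f ∘ suc) t N) ⟩
    ∑[ i < suc N ] δ (h (f (toℕ i))) t ∎
  by-head (no miss) = begin
    length (filter (λ k → h k ≟ t) (applyUpTo f (suc N)))
      ≡⟨ cong length (filter-reject (λ k → h k ≟ t) {xs = applyUpTo (f ∘ suc) N} miss) ⟩
    0 + rest ≡⟨ cong₂ _+_ (sym (δ-no miss)) (length-filter-≟ h (f ∘ suc) t N) ⟩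
    ∑[ i < suc N ] δ (h (f (toℕ i))) t ∎

Count-solutions : ∀ (h : ℕ → ℕ) t N →
  Count (λ k → k < N × h k ≡ t) (∑[ i < N ] δ (h (toℕ i)) t)
Count-solutions h t N =
  solutions , Unique.filter⁺ (λ k → h k ≟ t) (Unique.upTo⁺ N) , mem , length-filter-≟ h id t N
  where
  solutions : List ℕ
  solutions = filter (λ k → h k ≟ t) (upTo N)
  mem : ∀ k → (k ∈ solutions) ⇔ (k < N × h k ≡ t)
  mem k = mk⇔
    (λ k∈ → let (k∈upTo , hk≡t) = ∈-filter⁻ (λ k → h k ≟ t) {xs = upTo N} k∈ in ∈-upTo⁻ k∈upTo , hk≡t)
    (λ (k<N , hk≡t) → ∈-filter⁺ (λ k → h k ≟ t) (∈-upTo⁺ k<N) hk≡t)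

∑-sift : ∀ d (f : ℕ → ℕ) r → r < d → ∑[ i < d ] (f (toℕ i) * δ r (toℕ i)) ≡ f r
∑-sift (suc d) f zero _ = begin
  f 0 * 1 + ∑[ i < d ] (f (suc (toℕ i)) * 0) ≡⟨ cong₂ _+_ (*-identityʳ (f 0)) tail-vanishes ⟩
  f 0 + 0                                   ≡⟨ +-identityʳ (f 0) ⟩
  f 0                                       ∎
  where
  open ≡-Reasoning
  tail-vanishes : ∑[ i < d ] (f (suc (toℕ i)) * 0) ≡ 0
  tail-vanishes = trans (sum-cong-≗ {d} (λ i → *-zeroʳ (f (suc (toℕ i))))) (sum-replicate-zero d)
∑-sift (suc d) f (suc r) (s≤s r<d) = begin
  f 0 * 0 + ∑[ i < d ] (f (suc (toℕ i)) * δ (suc r) (suc (toℕ i)))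
    ≡⟨ cong₂ _+_ (*-zeroʳ (f 0)) (sum-cong-≗ {d} (λ i → cong (f (suc (toℕ i)) *_) (δ-suc r (toℕ i)))) ⟩
  ∑[ i < d ] (f (suc (toℕ i)) * δ r (toℕ i)) ≡⟨ ∑-sift d (f ∘ suc) r r<d ⟩
  f (suc r)                                  ∎
  where open ≡-Reasoning

sum-applyUpTo : ∀ (g f : ℕ → ℕ) N → sum (map g (applyUpTo f N)) ≡ ∑[ i < N ] g (f (toℕ i))
sum-applyUpTo g f zero = refl
sum-applyUpTo g f (suc N) = cong (g (f 0) ℕ.+_) (sum-applyUpTo g (f ∘ suc) N)

+-difference : ∀ {x a t} → x ≡ a + t → + a ≡ + x - + t
+-difference {a = a} {t} refl = sym (begin
  + (a + t) - + t ≡⟨ ℤ.[+m]-[+n]≡m⊖n (a + t) t ⟩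
  (a + t) ⊖ t     ≡⟨ ℤ.⊖-≥ (m≤n+m t a) ⟩
  + (a + t ∸ t)   ≡⟨ cong +_ (m+n∸n≡m a t) ⟩
  + a             ∎)
  where open ≡-Reasoning

div-mod-expansion : ∀ x d .{{_ : NonZero d}} → d * (x / d) + x % d ≡ x
div-mod-expansion x d = begin
  d * (x / d) + x % d ≡⟨ cong (_+ x % d) (*-comm d (x / d)) ⟩
  x / d * d + x % d   ≡⟨ +-comm (x / d * d) (x % d) ⟩
  x % d + x / d * d   ≡⟨ sym (m≡m%n+[m/n]*n x d) ⟩
  x                   ∎
  where open ≡-Reasoning

div-of-expansion : ∀ d .{{_ : NonZero d}} a r → r < d → (d * a + r) / d ≡ a
div-of-expansion d a r r<d = begin
  (d * a + r) / d   ≡⟨ cong (λ y → (y + r) / d) (*-comm d a) ⟩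
  (a * d + r) / d   ≡⟨ +-distrib-/ (a * d) r no-carry ⟩
  a * d / d + r / d ≡⟨ cong₂ _+_ (m*n/n≡m a d) (m<n⇒m/n≡0 r<d) ⟩
  a + 0             ≡⟨ +-identityʳ a ⟩
  a                 ∎
  where
  open ≡-Reasoning
  no-carry : a * d % d + r % d < d
  no-carry = subst₂ (λ x y → x + y < d) (sym (m*n%n≡0 a d)) (sym (m<n⇒m%n≡m r<d)) r<d

mod-of-expansion : ∀ d .{{_ : NonZero d}} a r → r < d → (d * a + r) % d ≡ r
mod-of-expansion d a r r<d = begin
  (d * a + r) % d ≡⟨ cong (_% d) (trans (+-comm (d * a) r) (cong (r ℕ.+_) (*-comm d a))) ⟩
  (r + a * d) % d ≡⟨ [m+kn]%n≡m%n r a d ⟩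
  r % d           ≡⟨ m<n⇒m%n≡m r<d ⟩
  r               ∎
  where open ≡-Reasoning

δ-child : ∀ d .{{_ : NonZero d}} x n j → j < d → δ x (d * n + j) ≡ δ (x / d) n * δ (x % d) j
δ-child d x n j j<d = by-cases (x ≟ d * n + j)
  where
  by-cases : Dec (x ≡ d * n + j) → δ x (d * n + j) ≡ δ (x / d) n * δ (x % d) j
  by-cases (yes x≡child) = begin
    δ x (d * n + j)             ≡⟨ δ-yes x≡child ⟩
    1 * 1                       ≡⟨ sym (cong₂ _*_ (δ-yes quot≡n) (δ-yes rem≡j)) ⟩
    δ (x / d) n * δ (x % d) j   ∎
    where
    open ≡-Reasoning
    quot≡n : x / d ≡ n
    quot≡n = trans (cong (_/ d) x≡child) (div-of-expansion d n j j<d)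
    rem≡j : x % d ≡ j
    rem≡j = trans (cong (_% d) x≡child) (mod-of-expansion d n j j<d)
  by-cases (no x≢child) = trans (δ-no x≢child) (sym (product-vanishes (x % d ≟ j)))
    where
    product-vanishes : Dec (x % d ≡ j) → δ (x / d) n * δ (x % d) j ≡ 0
    product-vanishes (no rem≢j) = trans (cong (δ (x / d) n *_) (δ-no rem≢j)) (*-zeroʳ (δ (x / d) n))
    product-vanishes (yes rem≡j) = cong (_* δ (x % d) j) (δ-no quot≢n)
      where
      quot≢n : ¬ x / d ≡ n
      quot≢n quot≡n = x≢child (trans (sym (div-mod-expansion x d)) (cong₂ (λ a r → d * a + r) quot≡n rem≡j))

∑-δ-children : ∀ d .{{_ : NonZero d}} x n → ∑[ j < d ] δ x (d * n + toℕ j) ≡ δ (x / d) n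
∑-δ-children d x n = begin
  ∑[ j < d ] δ x (d * n + toℕ j)                ≡⟨ sum-cong-≗ {d} (λ j → δ-child d x n (toℕ j) (toℕ<n j)) ⟩
  ∑[ j < d ] (δ (x / d) n * δ (x % d) (toℕ j)) ≡⟨ ∑-sift d (λ _ → δ (x / d) n) (x % d) (m%n<n x d) ⟩
  δ (x / d) n                                   ∎
  where
  open ≡-Reasoning

module Base (c : ℕ) where

  B : ℕ
  B = suc (suc c)

  -- Supplied explicitly to divisions by B^k: instance search cannot
  -- recover k from B^k.
  B^≢0 : ∀ k → NonZero (B ^ k)
  B^≢0 k = m^n≢0 B k

  infixl 7 _/B^_ _%B^_
  _/B^_ : ℕ → ℕ → ℕ
  x /B^ k = _/_ x (B ^ k) {{B^≢0 k}}

  _%B^_ : ℕ → ℕ → ℕ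
  x %B^ k = _%_ x (B ^ k) {{B^≢0 k}}

  /B^-zero : ∀ x → x /B^ 0 ≡ x
  /B^-zero = n/1≡n

  /B^-suc : ∀ x k → x /B^ k / B ≡ x /B^ suc k
  /B^-suc x k = trans (m/n/o≡m/[n*o] x (B ^ k) B {{B^≢0 k}} {{_}} {{m*n≢0 (B ^ k) B {{B^≢0 k}}}})
                      (/-congʳ {{m*n≢0 (B ^ k) B {{B^≢0 k}}}} {{B^≢0 (suc k)}} (*-comm (B ^ k) B))

  /B^-sucˡ : ∀ x k → x / B /B^ k ≡ x /B^ suc k
  /B^-sucˡ x k = m/n/o≡m/[n*o] x B (B ^ k) {{_}} {{B^≢0 k}} {{B^≢0 (suc k)}}

  %B^<B^ : ∀ x k → x %B^ k < B ^ k
  %B^<B^ x k = m%n<n x (B ^ k) {{B^≢0 k}}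

  B^-expansion : ∀ x k → B ^ k * (x /B^ k) + x %B^ k ≡ x
  B^-expansion x k = div-mod-expansion x (B ^ k) {{B^≢0 k}}

  B^-expansion-unique : ∀ x k a l → l < B ^ k → B ^ k * a + l ≡ x → x /B^ k ≡ a × x %B^ k ≡ l
  B^-expansion-unique x k a l l<B^k refl =
    div-of-expansion (B ^ k) {{B^≢0 k}} a l l<B^k , mod-of-expansion (B ^ k) {{B^≢0 k}} a l l<B^k

  k<B^k : ∀ k → k < B ^ k
  k<B^k zero = s≤s z≤n
  k<B^k (suc k) = ≤-<-trans (k<B^k k) (^-monoʳ-< B (s≤s (s≤s z≤n)) (n<1+n k))

  exponent-bound : ∀ {k a l m N} → 1 ≤ a → B ^ k * a + l ≡ m → m < B ^ N → k < N
  exponent-bound {k} {a} {l} {m} {N} 1≤a eq m<B^N = ≰⇒> N≰k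
    where
    B^k≤m : B ^ k ≤ m
    B^k≤m = ≤-trans (≤-trans (≤-reflexive (sym (*-identityʳ (B ^ k)))) (*-monoʳ-≤ (B ^ k) 1≤a))
                    (≤-trans (m≤m+n (B ^ k * a) l) (≤-reflexive eq))
    N≰k : ¬ N ≤ k
    N≰k N≤k = <⇒≱ (≤-<-trans B^k≤m m<B^N) (^-monoʳ-≤ B N≤k)

  -- The term index of RTerm, regrouped as an expansion in base B^k.
  regroup : ∀ k n j l → B ^ suc k * n + B ^ k * j + l ≡ B ^ k * (B * n + j) + l
  regroup k n j l = cong (_+ l) (solve 4 (λ b p n j → b :* p :* n :+ p :* j := p :* (b :* n :+ j)) refl B (B ^ k) n j)
    where open +-*-Solver

  digitSumAux-∑ : ∀ f x → digitSumAux B f x ≡ ∑[ k < f ] (x /B^ toℕ k % B)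
  digitSumAux-∑ zero x = refl
  digitSumAux-∑ (suc f) x = cong₂ _+_ (cong (_% B) (sym (/B^-zero x))) (begin
    digitSumAux B f (x / B)              ≡⟨ digitSumAux-∑ f (x / B) ⟩
    ∑[ k < f ] (x / B /B^ toℕ k % B)    ≡⟨ sum-cong-≗ {f} (λ k → cong (_% B) (/B^-sucˡ x (toℕ k))) ⟩
    ∑[ k < f ] (x /B^ suc (toℕ k) % B)  ∎)
    where open ≡-Reasoning

  module Expansion (m : ℕ) where

    q : ℕ → ℕ
    q k = m /B^ k

    digit : ℕ → ℕ
    digit k = q k % B

    -- Exponent ranges long enough to contain every term equal to g(m).
    m<B^m : m < B ^ m
    m<B^m = k<B^k m

    m<B^1+m : m < B ^ suc m
    m<B^1+m = <-trans (n<1+n m) (k<B^k (suc m))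

    -- Coefficient of g(m) in f(n), counted over exponents k < N.
    fCoef : ℕ → ℕ → ℕ
    fCoef N n = ∑[ k < N ] δ (q (toℕ k)) n

    -- Coefficient of g(m) in the j-th inner sum, counted over k < N.
    rCoef : ℕ → ℕ → ℕ
    rCoef N j = ∑[ k < N ] δ (digit (toℕ k)) j

    FTerm-count : ∀ N n → 1 ≤ n → m < B ^ N → Count (FTerm B n m) (fCoef N n)
    FTerm-count N n 1≤n m<B^N =
      Count-image (λ k → k , m %B^ k) proj₁ (λ _ → refl) sound complete (Count-solutions q n N)
      where
      sound : ∀ k → k < N × q k ≡ n → FTerm B n m (k , m %B^ k)
      sound k (_ , refl) = %B^<B^ m k , B^-expansion m k
      complete : ∀ x → FTerm B n m x → (proj₁ x < N × q (proj₁ x) ≡ n) × (proj₁ x , m %B^ proj₁ x) ≡ x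
      complete (k , l) (l<B^k , eq) =
        let (qk≡n , rk≡l) = B^-expansion-unique m k n l l<B^k eq
        in (exponent-bound 1≤n eq m<B^N , qk≡n) , cong (k ,_) rk≡l

    RTerm-count : ∀ N j → 1 ≤ j → j < B → m < B ^ N → Count (RTerm B j m) (rCoef N j)
    RTerm-count N j 1≤j j<B m<B^N =
      Count-image (λ k → q k / B , k , m %B^ k) (proj₁ ∘ proj₂) (λ _ → refl) sound complete
        (Count-solutions digit j N)
      where
      sound : ∀ k → k < N × digit k ≡ j → RTerm B j m (q k / B , k , m %B^ k)
      sound k (_ , refl) = %B^<B^ m k , (begin
        B ^ suc k * (q k / B) + B ^ k * digit k + m %B^ k ≡⟨ regroup k (q k / B) (digit k) (m %B^ k) ⟩
        B ^ k * (B * (q k / B) + q k % B) + m %B^ k      ≡⟨ cong (λ y → B ^ k * y + m %B^ k) (div-mod-expansion (q k) B) ⟩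
        B ^ k * q k + m %B^ k                            ≡⟨ B^-expansion m k ⟩
        m                                                ∎)
        where open ≡-Reasoning
      complete : ∀ x → RTerm B j m x →
        (proj₁ (proj₂ x) < N × digit (proj₁ (proj₂ x)) ≡ j) ×
        (q (proj₁ (proj₂ x)) / B , proj₁ (proj₂ x) , m %B^ proj₁ (proj₂ x)) ≡ x
      complete (n , k , l) (l<B^k , eq) =
        (exponent-bound (≤-trans 1≤j (m≤n+m j (B * n))) expansion m<B^N ,
         trans (cong (_% B) qk≡child) (mod-of-expansion B n j j<B)) ,
        cong₂ _,_ (trans (cong (_/ B) qk≡child) (div-of-expansion B n j j<B)) (cong (k ,_) rk≡l)
        where
        expansion : B ^ k * (B * n + j) + l ≡ m
        expansion = trans (sym (regroup k n j l)) eq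
        qk≡child : q k ≡ B * n + j
        qk≡child = proj₁ (B^-expansion-unique m k (B * n + j) l l<B^k expansion)
        rk≡l : m %B^ k ≡ l
        rk≡l = proj₂ (B^-expansion-unique m k (B * n + j) l l<B^k expansion)

    -- First identity, coefficientwise: f(n) = g(n) + Σ_{j<B} f(Bn + j),
    -- where the exponent range on the left is one longer than on the right.
    f-recursion : ∀ N n → fCoef (suc N) n ≡ δ m n + ∑[ j < B ] fCoef N (B * n + toℕ j)
    f-recursion N n = begin
      δ (q 0) n + ∑[ k < N ] δ (q (suc (toℕ k))) n
        ≡⟨ cong₂ _+_ (cong (λ y → δ y n) (/B^-zero m)) (sum-cong-≗ {N} (λ k → cong (λ y → δ y n) (sym (/B^-suc m (toℕ k))))) ⟩
      δ m n + ∑[ k < N ] δ (q (toℕ k) / B) n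
        ≡⟨ cong (δ m n ℕ.+_) (sum-cong-≗ {N} (λ k → sym (∑-δ-children B (q (toℕ k)) n))) ⟩
      δ m n + ∑[ k < N ] ∑[ j < B ] δ (q (toℕ k)) (B * n + toℕ j)
        ≡⟨ cong (δ m n ℕ.+_) (∑-comm {N} {B} (λ k j → δ (q (toℕ k)) (B * n + toℕ j))) ⟩
      δ m n + ∑[ j < B ] fCoef N (B * n + toℕ j) ∎
      where open ≡-Reasoning

    digits-by-value : ∀ N → ∑[ k < N ] digit (toℕ k) ≡ ∑[ j < B ] (toℕ j * rCoef N (toℕ j))
    digits-by-value N = sym (begin
      ∑[ j < B ] (toℕ j * rCoef N (toℕ j))
        ≡⟨ sum-cong-≗ {B} (λ j → *-distribˡ-sum {N} (toℕ j) (λ k → δ (digit (toℕ k)) (toℕ j))) ⟩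
      ∑[ j < B ] ∑[ k < N ] (toℕ j * δ (digit (toℕ k)) (toℕ j))
        ≡⟨ ∑-comm {B} {N} (λ j k → toℕ j * δ (digit (toℕ k)) (toℕ j)) ⟩
      ∑[ k < N ] ∑[ j < B ] (toℕ j * δ (digit (toℕ k)) (toℕ j))
        ≡⟨ sum-cong-≗ {N} (λ k → ∑-sift B id (digit (toℕ k)) (m%n<n (q (toℕ k)) B)) ⟩
      ∑[ k < N ] digit (toℕ k) ∎)
      where open ≡-Reasoning

    lhsCoef-digits : lhsCoef B m ≡ ∑[ k < m ] digit (toℕ k)
    lhsCoef-digits = trans (lhsCoef≡digitSum m) (digitSumAux-∑ m m)
      where
      lhsCoef≡digitSum : ∀ x → lhsCoef B x ≡ digitSum B x
      lhsCoef≡digitSum zero = refl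
      lhsCoef≡digitSum (suc x) = refl

    f-identity : ∀ n x (cs : ℕ → ℕ) → 1 ≤ n → Count (FTerm B n m) x →
      (∀ j → j < B → Count (FTerm B (B * n + j) m) (cs j)) →
      x ≡ δ m n + sum (map cs (upTo B))
    f-identity n x cs 1≤n count countChildren = begin
      x                                          ≡⟨ Count-unique count (FTerm-count (suc m) n 1≤n m<B^1+m) ⟩
      fCoef (suc m) n                            ≡⟨ f-recursion m n ⟩
      δ m n + ∑[ j < B ] fCoef m (B * n + toℕ j) ≡⟨ cong (δ m n ℕ.+_) (sum-cong-≗ {B} children) ⟩
      δ m n + ∑[ j < B ] cs (toℕ j)              ≡⟨ cong (δ m n ℕ.+_) (sym (sum-applyUpTo cs id B)) ⟩
      δ m n + sum (map cs (upTo B))              ∎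
      where
      open ≡-Reasoning
      children : ∀ j → fCoef m (B * n + toℕ j) ≡ cs (toℕ j)
      children j = Count-unique
        (FTerm-count m (B * n + toℕ j) (≤-trans 1≤n (≤-trans (m≤n*m n B) (m≤m+n (B * n) (toℕ j)))) m<B^m)
        (countChildren (toℕ j) (toℕ<n j))

    digit-sum-identity : (rs : ℕ → ℕ) → (∀ j → 1 ≤ j → j < B → Count (RTerm B j m) (rs j)) →
      lhsCoef B m ≡ sum (map (λ j → j * rs j) (map suc (upTo (suc c))))
    digit-sum-identity rs counts = begin
      lhsCoef B m                                            ≡⟨ lhsCoef-digits ⟩
      ∑[ k < m ] digit (toℕ k)                               ≡⟨ digits-by-value m ⟩
      ∑[ i < suc c ] (suc (toℕ i) * rCoef m (suc (toℕ i))) ≡⟨ sum-cong-≗ {suc c} (λ i → cong (suc (toℕ i) *_) (nonzero-digit i)) ⟩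
      ∑[ i < suc c ] (suc (toℕ i) * rs (suc (toℕ i)))      ≡⟨ sym (sum-applyUpTo (λ j → suc j * rs (suc j)) id (suc c)) ⟩
      sum (map (λ j → suc j * rs (suc j)) (upTo (suc c)))   ≡⟨ cong sum (map-∘ (upTo (suc c))) ⟩
      sum (map (λ j → j * rs j) (map suc (upTo (suc c))))   ∎
      where
      open ≡-Reasoning
      nonzero-digit : ∀ i → rCoef m (suc (toℕ i)) ≡ rs (suc (toℕ i))
      nonzero-digit i = Count-unique (RTerm-count m (suc (toℕ i)) (s≤s z≤n) (s≤s (toℕ<n i)) m<B^m)
                                     (counts (suc (toℕ i)) (s≤s z≤n) (s≤s (toℕ<n i)))

theorem27 : (b : ℕ) → 2 ≤ b →
    ((n m : ℕ) → 1 ≤ n → ∃[ c ] Count (FTerm b n m) c)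
    ×
    ((n m c : ℕ) (cs : ℕ → ℕ) → 1 ≤ n →
      Count (FTerm b n m) c →
      ((j : ℕ) → j < b → Count (FTerm b (b * n + j) m) (cs j)) →
      + δ m n ≡ + c - + sum (map cs (upTo b)))
    ×
    ((j m : ℕ) → 1 ≤ j → j < b → ∃[ c ] Count (RTerm b j m) c)
    ×
    ((m : ℕ) (rs : ℕ → ℕ) →
      ((j : ℕ) → 1 ≤ j → j < b → Count (RTerm b j m) (rs j)) →
      lhsCoef b m ≡ sum (map (λ j → j * rs j) (map suc (upTo (b ∸ 1)))))
theorem27 zero ()
theorem27 (suc zero) (s≤s ())
theorem27 (suc (suc c)) _ =
    (λ n m 1≤n → fCoef m m n , FTerm-count m m n 1≤n (m<B^m m))
  , (λ n m x cs 1≤n count countChildren → +-difference (f-identity m n x cs 1≤n count countChildren))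
  , (λ j m 1≤j j<B → rCoef m m j , RTerm-count m m j 1≤j j<B (m<B^m m))
  , digit-sum-identity
  where
  open Base c
  open Expansion
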